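{- Let $(A,\rightarrow,\rightsquigarrow,1)$ be a pseudo-BE(A) algebra and $\mu$ an internal state of type II on $A$. Then $\mathrm{Ker}(\mu)=\{x\in A\mid\mu(x)=1\}$ is a fantastic deductive system of $A$.
   Context: A pseudo-BE algebra is an algebra $(A,\rightarrow,\rightsquigarrow,1)$ of type $(2,2,0)$ such that for all $x,y,z\in A$: $x\rightarrow x=x\rightsquigarrow x=1$; $x\rightarrow 1=x\rightsquigarrow 1=1$; $1\rightarrow x=1\rightsquigarrow x=x$; $x\rightarrow(y\rightsquigarrow z)=y\rightsquigarrow(x\rightarrow z)$; $x\rightarrow y=1$ iff $x\rightsquigarrow y=1$. Write $x\le y$ iff $x\rightarrow y=1$. It is a pseudo-BE(A) algebra if $x\le y$ implies $y\rightarrow z\le x\rightarrow z$ and $y\rightsquigarrow z\le x\rightsquigarrow z$ for all $z$. Put $x\vee_1 y=(x\rightarrow y)\rightsquigarrow y$, $x\vee_2 y=(x\rightsquigarrow y)\rightarrow y$. An internal state of type II is a map $\mu:A\to A$ such that for all $x,y$: (is1) $x\le y$ implies $\mu(x)\le\mu(y)$; (is2') $\mu(x\rightarrow y)=\mu(y\vee_1 x)\rightarrow\mu(y)$ and $\mu(x\rightsquigarrow y)=\mu(y\vee_2 x)\rightsquigarrow\mu(y)$; (is3) $\mu(\mu(x)\rightarrow\mu(y))=\mu(x)\rightarrow\mu(y)$ and $\mu(\mu(x)\rightsquigarrow\mu(y))=\mu(x)\rightsquigarrow\mu(y)$. A deductive system is $D\subseteq A$ with $1\in D$ such that $x\in D$,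 $x\rightarrow y\in D$ imply $y\in D$. It is fantastic if for all $x,y$: $y\rightarrow x\in D$ implies $(x\vee_1 y)\rightarrow x\in D$, and $y\rightsquigarrow x\in D$ implies $(x\vee_2 y)\rightsquigarrow x\in D$. -}

module Defs where

open import Level using (Level; suc; _⊔_)
open import Relation.Binary.PropositionalEquality using (_≡_)
open import Data.Product using (_×_)
open import Function.Bundles using (_⇔_)

record PseudoBE (a : Level) : Set (suc a) where
  infixr 5 _⇒_ _⇝_
  field
    Carrier : Set a
    _⇒_ : Carrier → Carrier → Carrier
    _⇝_ : Carrier → Carrier → Carrier
    one : Carrier
    refl-⇒ : ∀ x → x ⇒ x ≡ one
    refl-⇝ : ∀ x → x ⇝ x ≡ one
    ⇒-one : ∀ x → x ⇒ one ≡ one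
    ⇝-one : ∀ x → x ⇝ one ≡ one
    one-⇒ : ∀ x → one ⇒ x ≡ x
    one-⇝ : ∀ x → one ⇝ x ≡ x
    exchange : ∀ x y z → x ⇒ (y ⇝ z) ≡ y ⇝ (x ⇒ z)
    ⇒-one⇔⇝-one : ∀ x y → (x ⇒ y ≡ one) ⇔ (x ⇝ y ≡ one)

  _≤_ : Carrier → Carrier → Set a
  x ≤ y = x ⇒ y ≡ one

  _∨₁_ : Carrier → Carrier → Carrier
  x ∨₁ y = (x ⇒ y) ⇝ y

  _∨₂_ : Carrier → Carrier → Carrier
  x ∨₂ y = (x ⇝ y) ⇒ y

IsPseudoBEA : ∀ {a} → PseudoBE a → Set a
IsPseudoBEA A = ∀ x y z → x ≤ y → ((y ⇒ z) ≤ (x ⇒ z)) × ((y ⇝ z) ≤ (x ⇝ z))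
  where open PseudoBE A

record IsInternalStateII {a} (A : PseudoBE a) (μ : PseudoBE.Carrier A → PseudoBE.Carrier A) : Set a where
  open PseudoBE A
  field
    is1 : ∀ x y → x ≤ y → μ x ≤ μ y
    is2'-⇒ : ∀ x y → μ (x ⇒ y) ≡ μ (y ∨₁ x) ⇒ μ y
    is2'-⇝ : ∀ x y → μ (x ⇝ y) ≡ μ (y ∨₂ x) ⇝ μ y
    is3-⇒ : ∀ x y → μ (μ x ⇒ μ y) ≡ μ x ⇒ μ y
    is3-⇝ : ∀ x y → μ (μ x ⇝ μ y) ≡ μ x ⇝ μ y

record IsDeductiveSystem {a ℓ} (A : PseudoBE a) (D : PseudoBE.Carrier A → Set ℓ) : Set (a ⊔ ℓ) where
  open PseudoBE A
  field
    one∈D : D one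
    mp : ∀ x y → D x → D (x ⇒ y) → D y

record IsFantasticDS {a ℓ} (A : PseudoBE a) (D : PseudoBE.Carrier A → Set ℓ) : Set (a ⊔ ℓ) where
  open PseudoBE A
  field
    isDS : IsDeductiveSystem A D
    fant₁ : ∀ x y → D (y ⇒ x) → D ((x ∨₁ y) ⇒ x)
    fant₂ : ∀ x y → D (y ⇝ x) → D ((x ∨₂ y) ⇝ x)

Ker : ∀ {a} (A : PseudoBE a) → (PseudoBE.Carrier A → PseudoBE.Carrier A) → PseudoBE.Carrier A → Set a
Ker A μ x = μ x ≡ PseudoBE.one A

module Submission where

-- Everything follows from one consequence of axiom (is2'):
--   if  x ≤ z  then  μ (z → x) = μ z → μ x   (and likewise for ⇝),
-- because  x ≤ z  makes the join  x ∨₁ z = (x → z) ⇝ z  collapse to z.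
-- Applied with z = 1 it gives μ 1 = 1.  Applied with z = x ∨₁ y, which lies
-- above x, and combined with (is2') for y → x, it gives
--   μ ((x ∨₁ y) → x) = μ (x ∨₁ y) → μ x = μ (y → x),
-- which is exactly the fantastic condition, even as an equality.  Closure
-- under modus ponens uses that Ker(μ) is upward closed (by monotonicity
-- (is1)) and that x ≤ y ∨₁ x, so μ (x → y) = μ (y ∨₁ x) → μ y = 1 → μ y.

open import Level using (Level)
open import Defs
open import Relation.Binary.PropositionalEquality
open import Function.Bundles using (Equivalence)

module PseudoBEOrder {a : Level} (A : PseudoBE a) where
  open PseudoBE A

  ≤⇒⇝-one : ∀ {x y} → x ≤ y → x ⇝ y ≡ one
  ≤⇒⇝-one {x} {y} = Equivalence.to (⇒-one⇔⇝-one x y)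

  ⇝-one⇒≤ : ∀ {x y} → x ⇝ y ≡ one → x ≤ y
  ⇝-one⇒≤ {x} {y} = Equivalence.from (⇒-one⇔⇝-one x y)

  one-≤ : ∀ {y} → one ≤ y → y ≡ one
  one-≤ {y} 1≤y = trans (sym (one-⇒ y)) 1≤y

  ∨₁-upperˡ : ∀ x y → x ≤ (x ∨₁ y)
  ∨₁-upperˡ x y = trans (exchange x (x ⇒ y) y) (refl-⇝ (x ⇒ y))

  ∨₂-upperˡ : ∀ x y → x ≤ (x ∨₂ y)
  ∨₂-upperˡ x y = ⇝-one⇒≤ (trans (sym (exchange (x ⇝ y) x y)) (refl-⇒ (x ⇝ y)))

  ∨₁-upperʳ : ∀ x y → y ≤ (x ∨₁ y)
  ∨₁-upperʳ x y = begin
    y ⇒ ((x ⇒ y) ⇝ y)  ≡⟨ exchange y (x ⇒ y) y ⟩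
    (x ⇒ y) ⇝ (y ⇒ y)  ≡⟨ cong ((x ⇒ y) ⇝_) (refl-⇒ y) ⟩
    (x ⇒ y) ⇝ one      ≡⟨ ⇝-one (x ⇒ y) ⟩
    one                ∎
    where open ≡-Reasoning

  ∨₁-absorb : ∀ {x z} → x ≤ z → x ∨₁ z ≡ z
  ∨₁-absorb {x} {z} x≤z = trans (cong (_⇝ z) x≤z) (one-⇝ z)

  ∨₂-absorb : ∀ {x z} → x ≤ z → x ∨₂ z ≡ z
  ∨₂-absorb {x} {z} x≤z = trans (cong (_⇒ z) (≤⇒⇝-one x≤z)) (one-⇒ z)

module InternalStateII {a : Level} (A : PseudoBE a)
         (μ : PseudoBE.Carrier A → PseudoBE.Carrier A) (st : IsInternalStateII A μ) where
  open PseudoBE A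
  open PseudoBEOrder A
  open IsInternalStateII st

  μ-⇒-downward : ∀ {x z} → x ≤ z → μ (z ⇒ x) ≡ μ z ⇒ μ x
  μ-⇒-downward {x} {z} x≤z = trans (is2'-⇒ z x) (cong (λ t → μ t ⇒ μ x) (∨₁-absorb x≤z))

  μ-⇝-downward : ∀ {x z} → x ≤ z → μ (z ⇝ x) ≡ μ z ⇝ μ x
  μ-⇝-downward {x} {z} x≤z = trans (is2'-⇝ z x) (cong (λ t → μ t ⇝ μ x) (∨₂-absorb x≤z))

  μ-one : μ one ≡ one
  μ-one = begin
    μ one          ≡⟨ cong μ (sym (refl-⇒ one)) ⟩
    μ (one ⇒ one)  ≡⟨ μ-⇒-downward (refl-⇒ one) ⟩
    μ one ⇒ μ one  ≡⟨ refl-⇒ (μ one) ⟩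
    one            ∎
    where open ≡-Reasoning

  Ker-upward : ∀ {x y} → Ker A μ x → x ≤ y → Ker A μ y
  Ker-upward {x} {y} μx≡1 x≤y = one-≤ (subst (_≤ μ y) μx≡1 (is1 x y x≤y))

  μ-∨₁-⇒ : ∀ x y → μ ((x ∨₁ y) ⇒ x) ≡ μ (y ⇒ x)
  μ-∨₁-⇒ x y = trans (μ-⇒-downward (∨₁-upperˡ x y)) (sym (is2'-⇒ y x))

  μ-∨₂-⇝ : ∀ x y → μ ((x ∨₂ y) ⇝ x) ≡ μ (y ⇝ x)
  μ-∨₂-⇝ x y = trans (μ-⇝-downward (∨₂-upperˡ x y)) (sym (is2'-⇝ y x))

  Ker-mp : ∀ x y → Ker A μ x → Ker A μ (x ⇒ y) → Ker A μ y
  Ker-mp x y μx≡1 μx⇒y≡1 = begin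
    μ y                  ≡⟨ sym (one-⇒ (μ y)) ⟩
    one ⇒ μ y            ≡⟨ cong (_⇒ μ y) (sym (Ker-upward μx≡1 (∨₁-upperʳ y x))) ⟩
    μ (y ∨₁ x) ⇒ μ y     ≡⟨ sym (is2'-⇒ x y) ⟩
    μ (x ⇒ y)            ≡⟨ μx⇒y≡1 ⟩
    one                  ∎
    where open ≡-Reasoning

proposition5p15 : ∀ {a : Level} (A : PseudoBE a) → IsPseudoBEA A →
    (μ : PseudoBE.Carrier A → PseudoBE.Carrier A) → IsInternalStateII A μ →
    IsFantasticDS A (Ker A μ)
proposition5p15 A _ μ st = record
  { isDS  = record { one∈D = μ-one ; mp = Ker-mp }
  ; fant₁ = λ x y μy⇒x≡1 → trans (μ-∨₁-⇒ x y) μy⇒x≡1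
  ; fant₂ = λ x y μy⇝x≡1 → trans (μ-∨₂-⇝ x y) μy⇝x≡1
  }
  where open InternalStateII A μ st
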